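{- Let $n\ge1$ and let $l_1,l_2,l_3$ be positive integers. If $(x,y,z)$ belongs to the $n$-diagram of the $(l_1,l_2,l_3)$-tennis ball problem, then $(x',y,z')$ belongs to the $n$-diagram for all integers $x',z'$ with $0\le x'\le x$ and $z\le z'\le nl_3$.
   Context: $e_1,e_2,e_3$ are the unit coordinate vectors of $\mathbb{R}^3$; let $L=l_1+l_2+l_3$. The $(l_1,l_2,l_3)$-tennis ball problem: there are balls numbered $1,2,\ldots$ and bins $\Gamma_1,\Gamma_2,\Gamma_3$, initially empty. In turn $t$ ($t=1,2,\ldots$), balls $(t-1)L+1,\ldots,tL$ are put into $\Gamma_1$; then $l_2+l_3$ of the balls currently in $\Gamma_1$ (chosen arbitrarily) are moved to $\Gamma_2$, and then $l_3$ of the balls currently in $\Gamma_2$ are moved to $\Gamma_3$. An $n$-configuration is an ordered $3$-partition $(A_1,A_2,A_3)$ of $[nL]$ such that, for some choice of moves, after $n$ turns $A_j$ is exactly the set of balls in $\Gamma_j$. The associated $n$-configuration path is the lattice path $s_1\cdots s_{nL}$ from $(0,0,0)$ to $(nl_1,nl_2,nl_3)$ with $s_i=e_j$ whenever $i\in A_j$. The $n$-diagram is the set of points of $\mathbb{N}^3$ that lie on (i.e. are among the partial sums $s_1+\cdots+s_p$, $0\le p\le nL$, of) some $n$-configuration path. -}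

module Defs where

open import Data.Nat using (ℕ; zero; suc; _+_; _*_; _≤_)
open import Data.Fin using (Fin; zero; suc; _≟_)
open import Data.List using (List; []; _∷_; _++_; replicate; take; length; filter)
open import Data.Product using (Σ; _×_; _,_; ∃)
open import Relation.Binary.PropositionalEquality using (_≡_)

Bin : Set
Bin = Fin 3

Γ₁ Γ₂ Γ₃ : Bin
Γ₁ = zero
Γ₂ = suc zero
Γ₃ = suc (suc zero)

-- A state after t turns is a list of length t·L whose i-th entry (0-based)
-- is the bin containing ball i+1.

data MoveStep (from to : Bin) : ℕ → List Bin → List Bin → Set where
  done : MoveStep from to 0 [] []
  keep : ∀ {k x xs ys} → MoveStep from to k xs ys → MoveStep from to k (x ∷ xs) (x ∷ ys)
  move : ∀ {k xs ys} → MoveStep from to k xs ys → MoveStep from to (suc k) (from ∷ xs) (to ∷ ys)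

data Reach (l₁ l₂ l₃ : ℕ) : ℕ → List Bin → Set where
  start : Reach l₁ l₂ l₃ 0 []
  turn  : ∀ {t s s' s''} → Reach l₁ l₂ l₃ t s →
          MoveStep Γ₁ Γ₂ (l₂ + l₃) (s ++ replicate (l₁ + l₂ + l₃) Γ₁) s' →
          MoveStep Γ₂ Γ₃ l₃ s' s'' →
          Reach l₁ l₂ l₃ (suc t) s''

-- An n-configuration (A₁,A₂,A₃) is encoded by the list c with Reach n c:
-- ball i ∈ A_j iff the (i-1)-th entry of c is bin j.  The associated
-- configuration path has i-th step e_j iff ball i ∈ A_j.

count : Bin → List Bin → ℕ
count b xs = length (filter (_≟ b) xs)

point : ℕ → List Bin → ℕ × ℕ × ℕ
point p c = count Γ₁ (take p c) , count Γ₂ (take p c) , count Γ₃ (take p c)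

InDiagram : (l₁ l₂ l₃ n : ℕ) → ℕ × ℕ × ℕ → Set
InDiagram l₁ l₂ l₃ n v =
  Σ (List Bin) λ c → Reach l₁ l₂ l₃ n c × Σ ℕ λ p → p ≤ length c × point p c ≡ v

{-# OPTIONS --safe #-}
-- Say a configuration is obtained from another by a swap if the bins of two
-- consecutive balls i, i+1 are exchanged and ball i was in the lower bin.
-- Reachable configurations are closed under swaps: going back through the
-- moves of the last turn, a swap is either absorbed by letting the other of
-- the two balls make the move, or becomes a swap of the configuration before
-- the move.  A point of the diagram is a cut of a reachable configuration into
-- a prefix and a suffix.  Bubbling the first Γ₁-ball of the prefix past the
-- rest of the prefix lowers x by one.  Every configuration has n l₃ balls in
-- Γ₃, so if z < n l₃ the suffix has a Γ₃-ball, and bubbling it to the front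
-- of the suffix raises z by one.
module Submission where

open import Defs
open import Data.Nat using (ℕ; _≤_; _*_; suc; _+_; _∸_; _<_; z≤n; z<s; s<s; _≤′_; ≤′-refl; ≤′-step)
open import Data.Nat.Properties using (+-suc; +-identityʳ; m+n∸m≡n; m<n⇒0<n∸m; suc-injective; <⇒≤; ≤⇒≤′)
open import Data.Fin using (_≟_) renaming (_<_ to _≺_; _≤_ to _≼_)
open import Data.Fin.Properties using (<-trans; <-irrefl; ≤∧≢⇒<; <⇒≤pred; ≤fromℕ)
open import Data.List using (List; []; _∷_; _++_; [_]; _∷ʳ_; replicate; take; drop; length; filter)
open import Data.List.Properties using (++-assoc; take++drop≡id; length-++; length-++-≤ˡ; filter-++; filter-none; filter-accept; filter-reject)
open import Data.List.Membership.Propositional using (_∈_)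
open import Data.List.Membership.Propositional.Properties using (∈-∃++)
open import Data.List.Relation.Unary.All using (All; []; _∷_; universal)
open import Data.List.Relation.Unary.All.Properties using (replicate⁺)
open import Data.List.Relation.Unary.Any using (here; there)
open import Data.List.Relation.Binary.Permutation.Propositional using (_↭_; ↭-sym)
open import Data.List.Relation.Binary.Permutation.Propositional.Properties using (↭-length; filter-↭; shift; ∷↭∷ʳ)
open import Data.Product using (_,_; _×_; ∃; proj₁; proj₂)
import Data.Product as Product
open import Data.Sum using (_⊎_; inj₁; inj₂)
import Data.Sum as Sum
open import Data.Empty using (⊥-elim)
open import Function using (_∘_; id)
open import Relation.Binary.Construct.Closure.ReflexiveTransitive using (Star; ε; _◅_; _◅◅_; gmap)
open import Relation.Nullary using (¬_; yes; no)
open import Relation.Binary.PropositionalEquality using (_≡_; _≢_; refl; sym; trans; cong; cong₂; subst; module ≡-Reasoning)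

private
  variable
    a b f g h : Bin
    k m t : ℕ
    s s′ s″ u v w : List Bin

data Swap : List Bin → List Bin → Set where
  swap : a ≺ b → Swap (a ∷ b ∷ s) (b ∷ a ∷ s)
  skip : Swap s s′ → Swap (a ∷ s) (a ∷ s′)

Swap⋆ : List Bin → List Bin → Set
Swap⋆ = Star Swap

Swap-++⁺ˡ : ∀ u → Swap s s′ → Swap (u ++ s) (u ++ s′)
Swap-++⁺ˡ []      sw = sw
Swap-++⁺ˡ (a ∷ u) sw = skip (Swap-++⁺ˡ u sw)

Swap⋆-++⁺ˡ : ∀ u → Swap⋆ s s′ → Swap⋆ (u ++ s) (u ++ s′)
Swap⋆-++⁺ˡ u = gmap (u ++_) (Swap-++⁺ˡ u)

Swap⋆-≼ : a ≼ b → Swap⋆ (a ∷ b ∷ s) (b ∷ a ∷ s)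
Swap⋆-≼ {a} {b} a≼b with a ≟ b
... | yes refl = ε
... | no a≢b   = swap (≤∧≢⇒< a≼b a≢b) ◅ ε

bubbleʳ : All (a ≼_) v → Swap⋆ (a ∷ v ++ w) (v ++ a ∷ w)
bubbleʳ []                      = ε
bubbleʳ {v = b ∷ _} (a≼b ∷ a≼v) = Swap⋆-≼ a≼b ◅◅ gmap (b ∷_) skip (bubbleʳ a≼v)

bubbleˡ : All (_≼ a) v → Swap⋆ (v ++ a ∷ w) (a ∷ v ++ w)
bubbleˡ []                      = ε
bubbleˡ {v = b ∷ _} (b≼a ∷ v≼a) = gmap (b ∷_) skip (bubbleˡ v≼a) ◅◅ Swap⋆-≼ b≼a

¬Swap-replicate-Γ₁ : ∀ m → ¬ Swap (replicate m Γ₁) s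
¬Swap-replicate-Γ₁ (suc (suc m)) (swap ())
¬Swap-replicate-Γ₁ (suc m)       (skip sw) = ¬Swap-replicate-Γ₁ m sw

Swap-++-replicate-Γ₁ : ∀ s → Swap (s ++ replicate m Γ₁) s′ →
                       ∃ λ s″ → Swap s s″ × s′ ≡ s″ ++ replicate m Γ₁
Swap-++-replicate-Γ₁ {m}         []          sw         = ⊥-elim (¬Swap-replicate-Γ₁ m sw)
Swap-++-replicate-Γ₁ {m = suc m} (a ∷ [])    (swap ())
Swap-++-replicate-Γ₁ {m}         (a ∷ [])    (skip sw) = ⊥-elim (¬Swap-replicate-Γ₁ m sw)
Swap-++-replicate-Γ₁             (a ∷ b ∷ s) (swap a≺b) = b ∷ a ∷ s , swap a≺b , refl
Swap-++-replicate-Γ₁             (a ∷ b ∷ s) (skip sw) =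
  let s″ , sw′ , eq = Swap-++-replicate-Γ₁ (b ∷ s) sw in a ∷ s″ , skip sw′ , cong (a ∷_) eq

record _⋖_ (a b : Bin) : Set where
  field
    a≺b   : a ≺ b
    ≺b⇒≼a : ∀ {c : Bin} → c ≺ b → c ≼ a

-- pred Γ₂ and pred Γ₃ compute to Γ₁ and Γ₂.
Γ₁⋖Γ₂ : Γ₁ ⋖ Γ₂
Γ₁⋖Γ₂ = record { a≺b = z<s ; ≺b⇒≼a = λ {c} → <⇒≤pred {i = c} {j = Γ₂} }

Γ₂⋖Γ₃ : Γ₂ ⋖ Γ₃
Γ₂⋖Γ₃ = record { a≺b = s<s z<s ; ≺b⇒≼a = λ {c} → <⇒≤pred {i = c} {j = Γ₃} }

MoveStep-Swap : f ⋖ g → MoveStep f g k s s′ → Swap s′ s″ →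
                MoveStep f g k s s″ ⊎ ∃ λ t → Swap s t × MoveStep f g k t s″
MoveStep-Swap cov (keep {x = a} mv) (skip sw) =
  Sum.map keep (Product.map (a ∷_) (Product.map skip keep)) (MoveStep-Swap cov mv sw)
MoveStep-Swap {f} cov (move mv) (skip sw) =
  Sum.map move (Product.map (f ∷_) (Product.map skip move)) (MoveStep-Swap cov mv sw)
MoveStep-Swap cov (keep (keep mv)) (swap a≺b) = inj₂ (_ , swap a≺b , keep (keep mv))
MoveStep-Swap {f} cov (keep {x = a} (move mv)) (swap a≺g) with a ≟ f
... | yes refl = inj₁ (move (keep mv))
... | no a≢f   = inj₂ (_ , swap (≤∧≢⇒< (_⋖_.≺b⇒≼a cov a≺g) a≢f) , move (keep mv))
MoveStep-Swap cov (move (keep mv)) (swap g≺b) = inj₂ (_ , swap (<-trans (_⋖_.a≺b cov) g≺b) , keep (move mv))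
MoveStep-Swap cov (move (move mv)) (swap g≺g) = ⊥-elim (<-irrefl refl g≺g)

Reach-resp-Swap : ∀ {l₁ l₂ l₃} → Swap s s′ → Reach l₁ l₂ l₃ t s → Reach l₁ l₂ l₃ t s′
Reach-resp-Swap sw (turn {s = s} r mv₁ mv₂) with MoveStep-Swap Γ₂⋖Γ₃ mv₂ sw
... | inj₁ mv₂′ = turn r mv₁ mv₂′
... | inj₂ (_ , sw₁ , mv₂′) with MoveStep-Swap Γ₁⋖Γ₂ mv₁ sw₁
...   | inj₁ mv₁′ = turn r mv₁′ mv₂′
...   | inj₂ (_ , sw₀ , mv₁′) with Swap-++-replicate-Γ₁ s sw₀
...     | _ , sw , refl = turn (Reach-resp-Swap sw r) mv₁′ mv₂′

Reach-resp-Swap⋆ : ∀ {l₁ l₂ l₃} → Swap⋆ s s′ → Reach l₁ l₂ l₃ t s → Reach l₁ l₂ l₃ t s′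
Reach-resp-Swap⋆ ε          = id
Reach-resp-Swap⋆ (sw ◅ sws) = Reach-resp-Swap⋆ sws ∘ Reach-resp-Swap sw

count-++ : ∀ b u v → count b (u ++ v) ≡ count b u + count b v
count-++ b u v = trans (cong length (filter-++ (_≟ b) u v)) (length-++ (filter (_≟ b) u))

count-resp-↭ : ∀ b → u ↭ v → count b u ≡ count b v
count-resp-↭ b = ↭-length ∘ filter-↭ (_≟ b)

count-replicate-≢ : a ≢ b → ∀ m → count b (replicate m a) ≡ 0
count-replicate-≢ a≢b m = cong length (filter-none (_≟ _) (replicate⁺ m a≢b))

count-∷-≡ : ∀ b u → count b (b ∷ u) ≡ suc (count b u)
count-∷-≡ b u = cong length (filter-accept (_≟ b) refl)

count-∷-≢ : a ≢ b → ∀ u → count b (a ∷ u) ≡ count b u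
count-∷-≢ a≢b u = cong length (filter-reject (_≟ _) a≢b)

0<count⇒∈ : ∀ b u → 0 < count b u → b ∈ u
0<count⇒∈ b (a ∷ u) pos with a ≟ b
... | yes refl = here refl
... | no _     = there (0<count⇒∈ b u pos)

count-MoveStep-target : f ≢ g → MoveStep f g k s s′ → count g s′ ≡ k + count g s
count-MoveStep-target f≢g done = refl
count-MoveStep-target {g = g} {k = k} f≢g (keep {x = a} {xs = s} mv) with a ≟ g
... | yes _ = trans (cong suc (count-MoveStep-target f≢g mv)) (sym (+-suc k (count g s)))
... | no _  = count-MoveStep-target f≢g mv
count-MoveStep-target {f} {g} {suc k} f≢g (move {xs = s} {ys = s′} mv) = begin
  count g (g ∷ s′)          ≡⟨ count-∷-≡ g s′ ⟩
  suc (count g s′)          ≡⟨ cong suc (count-MoveStep-target f≢g mv) ⟩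
  suc (k + count g s)       ≡⟨ cong (λ c → suc (k + c)) (count-∷-≢ f≢g s) ⟨
  suc (k + count g (f ∷ s)) ∎
  where open ≡-Reasoning

count-MoveStep-other : f ≢ h → g ≢ h → MoveStep f g k s s′ → count h s′ ≡ count h s
count-MoveStep-other f≢h g≢h done = refl
count-MoveStep-other {h = h} f≢h g≢h (keep {x = a} mv) with a ≟ h
... | yes _ = cong suc (count-MoveStep-other f≢h g≢h mv)
... | no _  = count-MoveStep-other f≢h g≢h mv
count-MoveStep-other {f} {h} {g} f≢h g≢h (move {xs = s} {ys = s′} mv) = begin
  count h (g ∷ s′)  ≡⟨ count-∷-≢ g≢h s′ ⟩
  count h s′        ≡⟨ count-MoveStep-other f≢h g≢h mv ⟩
  count h s         ≡⟨ count-∷-≢ f≢h s ⟨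
  count h (f ∷ s)   ∎
  where open ≡-Reasoning

count-Γ₃-Reach : ∀ {l₁ l₂ l₃} → Reach l₁ l₂ l₃ t s → count Γ₃ s ≡ t * l₃
count-Γ₃-Reach start = refl
count-Γ₃-Reach {t = suc t} {l₁ = l₁} {l₂} {l₃} (turn {s = s} {s' = s′} {s'' = s″} r mv₁ mv₂) = begin
  count Γ₃ s″                                 ≡⟨ count-MoveStep-target (λ ()) mv₂ ⟩
  l₃ + count Γ₃ s′                            ≡⟨ cong (l₃ +_) (count-MoveStep-other (λ ()) (λ ()) mv₁) ⟩
  l₃ + count Γ₃ (s ++ replicate L Γ₁)         ≡⟨ cong (l₃ +_) (count-++ Γ₃ s (replicate L Γ₁)) ⟩
  l₃ + (count Γ₃ s + count Γ₃ (replicate L Γ₁)) ≡⟨ cong (λ c → l₃ + (count Γ₃ s + c)) (count-replicate-≢ (λ ()) L) ⟩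
  l₃ + (count Γ₃ s + 0)                       ≡⟨ cong (l₃ +_) (+-identityʳ _) ⟩
  l₃ + count Γ₃ s                             ≡⟨ cong (l₃ +_) (count-Γ₃-Reach r) ⟩
  l₃ + t * l₃                                 ∎
  where
    open ≡-Reasoning
    L = l₁ + l₂ + l₃

count-Γ₃-suffix : ∀ {l₁ l₂ l₃} u w → Reach l₁ l₂ l₃ t (u ++ w) → count Γ₃ w ≡ t * l₃ ∸ count Γ₃ u
count-Γ₃-suffix {t} {l₃ = l₃} u w r = begin
  count Γ₃ w                                     ≡⟨ m+n∸m≡n (count Γ₃ u) (count Γ₃ w) ⟨
  count Γ₃ u + count Γ₃ w ∸ count Γ₃ u           ≡⟨ cong (_∸ count Γ₃ u) (count-++ Γ₃ u w) ⟨
  count Γ₃ (u ++ w) ∸ count Γ₃ u                 ≡⟨ cong (_∸ count Γ₃ u) (count-Γ₃-Reach r) ⟩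
  t * l₃ ∸ count Γ₃ u                            ∎
  where open ≡-Reasoning

take-length-++ : ∀ (u v : List Bin) → take (length u) (u ++ v) ≡ u
take-length-++ []      v = refl
take-length-++ (a ∷ u) v = cong (a ∷_) (take-length-++ u v)

record Cut (l₁ l₂ l₃ n x y z : ℕ) : Set where
  field
    prefix suffix : List Bin
    reach  : Reach l₁ l₂ l₃ n (prefix ++ suffix)
    count₁ : count Γ₁ prefix ≡ x
    count₂ : count Γ₂ prefix ≡ y
    count₃ : count Γ₃ prefix ≡ z

module _ {l₁ l₂ l₃ n : ℕ} where

  InDiagram⇒Cut : ∀ {x y z} → InDiagram l₁ l₂ l₃ n (x , y , z) → Cut l₁ l₂ l₃ n x y z
  InDiagram⇒Cut (c , r , p , _ , eq) = record
    { prefix = take p c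
    ; suffix = drop p c
    ; reach  = subst (Reach l₁ l₂ l₃ n) (sym (take++drop≡id p c)) r
    ; count₁ = cong proj₁ eq
    ; count₂ = cong (proj₁ ∘ proj₂) eq
    ; count₃ = cong (proj₂ ∘ proj₂) eq
    }

  Cut⇒InDiagram : ∀ {x y z} → Cut l₁ l₂ l₃ n x y z → InDiagram l₁ l₂ l₃ n (x , y , z)
  Cut⇒InDiagram record { prefix = u ; suffix = w ; reach = r ; count₁ = c₁ ; count₂ = c₂ ; count₃ = c₃ } =
    u ++ w , r , length u , length-++-≤ˡ u ,
    (begin
      point (length u) (u ++ w)                  ≡⟨ cong (λ v → count Γ₁ v , count Γ₂ v , count Γ₃ v) (take-length-++ u w) ⟩
      (count Γ₁ u , count Γ₂ u , count Γ₃ u)     ≡⟨ cong₂ _,_ c₁ (cong₂ _,_ c₂ c₃) ⟩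
      _                                          ∎)
    where open ≡-Reasoning

  Cut-pred₁ : ∀ {x y z} → Cut l₁ l₂ l₃ n (suc x) y z → Cut l₁ l₂ l₃ n x y z
  Cut-pred₁ record { prefix = u ; suffix = w ; reach = r ; count₁ = c₁ ; count₂ = c₂ ; count₃ = c₃ }
    with ∈-∃++ (0<count⇒∈ Γ₁ u (subst (0 <_) (sym c₁) z<s))
  ... | u₁ , v , refl = record
    { prefix = u₁ ++ v
    ; suffix = Γ₁ ∷ w
    ; reach  = subst (Reach l₁ l₂ l₃ n) (sym (++-assoc u₁ v (Γ₁ ∷ w)))
                 (Reach-resp-Swap⋆ (Swap⋆-++⁺ˡ u₁ (bubbleʳ (universal (λ _ → z≤n) v)))
                   (subst (Reach l₁ l₂ l₃ n) (++-assoc u₁ (Γ₁ ∷ v) w) r))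
    ; count₁ = suc-injective (trans (sym (count-shift Γ₁)) c₁)
    ; count₂ = trans (sym (count-shift Γ₂)) c₂
    ; count₃ = trans (sym (count-shift Γ₃)) c₃
    }
    where
      count-shift : ∀ b → count b (u₁ ++ Γ₁ ∷ v) ≡ count b (Γ₁ ∷ u₁ ++ v)
      count-shift b = count-resp-↭ b (shift Γ₁ u₁ v)

  Cut-suc₃ : ∀ {x y z} → z < n * l₃ → Cut l₁ l₂ l₃ n x y z → Cut l₁ l₂ l₃ n x y (suc z)
  Cut-suc₃ z<nl₃ record { prefix = u ; suffix = w ; reach = r ; count₁ = c₁ ; count₂ = c₂ ; count₃ = c₃ }
    with ∈-∃++ (0<count⇒∈ Γ₃ w (subst (0 <_) (sym (count-Γ₃-suffix u w r))
                                  (m<n⇒0<n∸m (subst (_< n * l₃) (sym c₃) z<nl₃))))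
  ... | v , w₂ , refl = record
    { prefix = u ∷ʳ Γ₃
    ; suffix = v ++ w₂
    ; reach  = subst (Reach l₁ l₂ l₃ n) (sym (++-assoc u [ Γ₃ ] (v ++ w₂)))
                 (Reach-resp-Swap⋆ (Swap⋆-++⁺ˡ u (bubbleˡ (universal ≤fromℕ v))) r)
    ; count₁ = trans (count-∷ʳ Γ₁) c₁
    ; count₂ = trans (count-∷ʳ Γ₂) c₂
    ; count₃ = trans (count-∷ʳ Γ₃) (cong suc c₃)
    }
    where
      count-∷ʳ : ∀ b → count b (u ∷ʳ Γ₃) ≡ count b (Γ₃ ∷ u)
      count-∷ʳ b = count-resp-↭ b (↭-sym (∷↭∷ʳ Γ₃ u))

  Cut-lower₁ : ∀ {x x′ y z} → x′ ≤′ x → Cut l₁ l₂ l₃ n x y z → Cut l₁ l₂ l₃ n x′ y z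
  Cut-lower₁ ≤′-refl        = id
  Cut-lower₁ (≤′-step x′≤x) = Cut-lower₁ x′≤x ∘ Cut-pred₁

  Cut-raise₃ : ∀ {x y z z′} → z ≤′ z′ → z′ ≤ n * l₃ → Cut l₁ l₂ l₃ n x y z → Cut l₁ l₂ l₃ n x y z′
  Cut-raise₃ ≤′-refl        _      = id
  Cut-raise₃ (≤′-step z≤z′) z′<nl₃ = Cut-suc₃ z′<nl₃ ∘ Cut-raise₃ z≤z′ (<⇒≤ z′<nl₃)

corollary3p3 : (n l₁ l₂ l₃ : ℕ) → 1 ≤ n → 1 ≤ l₁ → 1 ≤ l₂ → 1 ≤ l₃ →
    (x y z : ℕ) → InDiagram l₁ l₂ l₃ n (x , y , z) →
    (x' z' : ℕ) → x' ≤ x → z ≤ z' → z' ≤ n * l₃ →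
    InDiagram l₁ l₂ l₃ n (x' , y , z')
corollary3p3 n l₁ l₂ l₃ _ _ _ _ x y z d x' z' x'≤x z≤z' z'≤nl₃ =
  Cut⇒InDiagram (Cut-raise₃ (≤⇒≤′ z≤z') z'≤nl₃ (Cut-lower₁ (≤⇒≤′ x'≤x) (InDiagram⇒Cut d)))
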